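{- Let $\mathbb{P}$ and $\mathbb{V}$ be algebraic theories, with $\mathbb{P}$ consistent, $T_{\mathbb{P}}$ a stable universal set of $\mathbb{P}$-terms and $T_{\mathbb{V}}$ a stable universal set of $\mathbb{V}$-terms. Suppose there are terms $2 \vdash_{\mathbb{P}} p$ and $2 \vdash_{\mathbb{V}} v$ such that: (P1) $2 \vdash p(1,2) =_{\mathbb{P}} p(2,1)$; (P2) there is a substitution $f_p$ assigning to each variable of $p$ a term of $T_{\mathbb{P}}$ such that $\Gamma \vdash p(1, f_p(2)) =_{\mathbb{P}} 1$; (P3) for all $n \vdash p' \in T_{\mathbb{P}}$: if $n \vdash p(1,2) =_{\mathbb{P}} p'$ then $2 \vdash p'$; (V1) $1 \vdash v(1,1) =_{\mathbb{V}} 1$; (V2) for all $v' \in T_{\mathbb{V}}$ and each variable $x$: if $\Gamma \vdash x =_{\mathbb{V}} v'$ then $\{x\} \vdash v'$; (V3) for all $v' \in T_{\mathbb{V}}$: if $\Gamma \vdash v(1,2) =_{\mathbb{V}} v'$ then neither $\{1\}\vdash v'$ nor $\{2\} \vdash v'$. Then there is no composite theory of $\mathbb{P}$ after $\mathbb{V}$.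
   Context: An algebraic theory consists of a signature and equations; $=_{\mathbb T}$ is provable equality. Variables are natural numbers and $n$ also denotes $\{1,\dots,n\}$; $Y\vdash t$ means all variables of $t$ lie in $Y$; $\Gamma$ is an arbitrary variable context; $p(a,b)$ is $p$ with $a$ substituted for $1$ and $b$ for $2$. A theory is consistent if it does not prove $x=y$ for distinct variables. A set of terms is universal if every term is provably equal to a member, and stable if closed under substituting variables for variables. For theories $\mathbb{S},\mathbb{T}$ (here $\mathbb{T}=\mathbb{P}$, $\mathbb{S}=\mathbb{V}$): $\mathbb{U}$ contains them if its signature contains both signatures and their equations are provable in $\mathbb{U}$; a separated term is $t[s_x/x]$ with $t$ a $\mathbb{T}$-term with variables in $X$ and $s_x$ $\mathbb{S}$-terms; separated terms $t[s_x/x]$, $t'[s'_{x'}/x']$ are equal modulo $(\mathbb{T},\mathbb{S})$ if there are $f:X\to Y$, $f':X'\to Y$ and $\mathbb{S}$-terms $\bar s_y$ with $t[f(x)/x]=_{\mathbb T}t'[f'(x')/x']$, $s_x=_{\mathbb S}\bar s_{f(x)}$, $s'_{x'}=_{\mathbb S}\bar s_{f'(x')}$; $\mathbb{U}$ is a composite theory of $\mathbb{T}$ after $\mathbb{S}$ if every $\mathbb U$-term is $\mathbb U$-equal to a separated term and any two separated terms $\mathbb U$-equal to a common term are equal modulo $(\mathbb{T},\mathbb{S})$. -}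

module Defs where

open import Data.Nat using (ℕ; zero; suc; _≤_)
open import Data.Fin using (Fin; cast)
open import Data.Product using (Σ; ∃; _×_; _,_)
open import Relation.Binary.PropositionalEquality using (_≡_; _≢_)
open import Relation.Nullary using (¬_)
open import Function.Definitions using (Injective)

record Signature : Set₁ where
  field
    Op : Set
    ar : Op → ℕ
open Signature public

data Term (S : Signature) : Set where
  var : ℕ → Term S
  op  : (o : Op S) → (Fin (ar S o) → Term S) → Term S

subst : {S : Signature} → (ℕ → Term S) → Term S → Term S
subst σ (var x)   = σ x
subst σ (op o ts) = op o (λ i → subst σ (ts i))

rename : {S : Signature} → (ℕ → ℕ) → Term S → Term S
rename ρ = subst (λ x → var (ρ x))

data Occurs {S : Signature} (x : ℕ) : Term S → Set where
  here  : Occurs x (var x)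
  under : ∀ {o ts} (i : Fin (ar S o)) → Occurs x (ts i) → Occurs x (op o ts)

infix 4 _⊢_
_⊢_ : {S : Signature} → (ℕ → Set) → Term S → Set
Y ⊢ t = ∀ x → Occurs x t → Y x

⟦_⟧ : ℕ → ℕ → Set
⟦ n ⟧ x = (1 ≤ x) × (x ≤ n)

｛_｝ : ℕ → ℕ → Set
｛ y ｝ x = x ≡ y

pair : {S : Signature} → Term S → Term S → ℕ → Term S
pair a b 1 = a
pair a b 2 = b
pair a b x = var x

infixl 30 _⟨_,_⟩
_⟨_,_⟩ : {S : Signature} → Term S → Term S → Term S → Term S
p ⟨ a , b ⟩ = subst (pair a b) p

record Theory : Set₁ where
  field
    sig : Signature
    Ax  : Set
    lhs : Ax → Term sig
    rhs : Ax → Term sig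
open Theory public

TermOf : Theory → Set
TermOf T = Term (sig T)

data Prov (T : Theory) : TermOf T → TermOf T → Set where
  prefl  : ∀ {t} → Prov T t t
  psym   : ∀ {s t} → Prov T s t → Prov T t s
  ptrans : ∀ {s t u} → Prov T s t → Prov T t u → Prov T s u
  pcong  : ∀ (o : Op (sig T)) {ts us : Fin (ar (sig T) o) → TermOf T} →
           (∀ i → Prov T (ts i) (us i)) → Prov T (op o ts) (op o us)
  pax    : ∀ (e : Ax T) (σ : ℕ → TermOf T) →
           Prov T (subst σ (lhs T e)) (subst σ (rhs T e))

infix 4 Prov
syntax Prov T s t = s =[ T ] t

Consistent : Theory → Set
Consistent T = ∀ (x y : ℕ) → x ≢ y → ¬ (var x =[ T ] var y)

TermSet : Theory → Set₁
TermSet T = TermOf T → Set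

Universal : (T : Theory) → TermSet T → Set
Universal T A = ∀ (t : TermOf T) → ∃ λ t' → A t' × (t =[ T ] t')

Stable : (T : Theory) → TermSet T → Set
Stable T A = ∀ (t : TermOf T) (ρ : ℕ → ℕ) → A t → A (rename ρ t)

record SigIncl (S D : Signature) : Set where
  field
    fun    : Op S → Op D
    inj    : Injective _≡_ _≡_ fun
    ar-eq  : ∀ o → ar D (fun o) ≡ ar S o
open SigIncl public

translate : {S D : Signature} → SigIncl S D → Term S → Term D
translate ι (var x)   = var x
translate ι (op o ts) = op (fun ι o) (λ i → translate ι (ts (cast (ar-eq ι o) i)))

record Contains (U T : Theory) : Set where
  field
    incl  : SigIncl (sig T) (sig U)
    eqns  : ∀ (e : Ax T) →
            translate incl (lhs T e) =[ U ] translate incl (rhs T e)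
open Contains public

module _ (T S : Theory) where

  -- a separated term t[s_x/x] is given by the T-term t (X = variables of t)
  -- and an assignment s of S-terms to variables
  Separated : Set
  Separated = TermOf T × (ℕ → TermOf S)

  EqMod : Separated → Separated → Set
  EqMod (t , s) (t' , s') =
    Σ (ℕ → ℕ) λ f → Σ (ℕ → ℕ) λ f' → Σ (ℕ → TermOf S) λ sbar →
      (rename f t =[ T ] rename f' t')
      × (∀ x → Occurs x t → s x =[ S ] sbar (f x))
      × (∀ x' → Occurs x' t' → s' x' =[ S ] sbar (f' x'))

  record Composite (U : Theory) : Set where
    field
      containsT : Contains U T
      containsS : Contains U S
    sep : Separated → TermOf U
    sep (t , s) = subst (λ x → translate (incl containsS) (s x))
                        (translate (incl containsT) t)
    field
      separation : ∀ (u : TermOf U) → ∃ λ (ts : Separated) → u =[ U ] sep ts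
      uniqueness : ∀ (a b : Separated) (u : TermOf U) →
                   u =[ U ] sep a → u =[ U ] sep b → EqMod a b

HasComposite : Theory → Theory → Set₁
HasComposite T S = Σ Theory λ U → Composite T S U

-- In a composite theory U consider u = v(p(1,3), p(2,4)). Identifying 2 with 1 and 4 with 3
-- turns u into v(p(1,3), p(1,3)) = p(1,3); identifying 4 with 1 and 2 with 3 turns it into
-- v(p(1,3), p(3,1)), which is p(1,3) again by commutativity of p. Comparing a separated form
-- t[s_x/x] of u with the separated form p(1,3)[x/x] of these two images, (P3) and (V2) force
-- every s_x to be a variable, and the two identifications together determine which one; so u
-- is a pure P-term q. Substituting right units of p for 3 and 4 turns u into v(1,2), so v(1,2)
-- is also a pure P-term. Uniqueness of separated forms against 1[v(1,2)/1] then makes v(1,2)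
-- provably a variable in V, which (V1) and (V3) exclude.
module Submission where

open import Defs
open import Level using (0ℓ)
open import Data.Nat using (ℕ; suc; z≤n; s≤s)
open import Data.Nat.Properties using (_≟_; 1+n≢n; ≤-trans; ≤-reflexive; n≮n)
open import Data.Fin using (cast)
open import Data.Fin.Properties using (any?)
open import Data.Product using (Σ; ∃; _×_; _,_; proj₁; proj₂)
open import Data.Sum using (_⊎_; inj₁; inj₂)
open import Data.Empty using (⊥-elim)
open import Function using (_∘_)
open import Relation.Nullary using (¬_; Dec; yes; no)
open import Relation.Binary.Bundles using (Setoid)
open import Relation.Binary.PropositionalEquality using (_≡_; _≢_; refl; sym; trans; cong; cong₂)
import Relation.Binary.Reasoning.Setoid as SetoidReasoning

provable-setoid : Theory → Setoid 0ℓ 0ℓ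
provable-setoid T = record
  { Carrier       = TermOf T
  ; _≈_           = Prov T
  ; isEquivalence = record { refl = prefl ; sym = psym ; trans = ptrans }
  }

module ≈-Reasoning (T : Theory) = SetoidReasoning (provable-setoid T)

≡⇒prov : ∀ {T} {s t : TermOf T} → s ≡ t → s =[ T ] t
≡⇒prov refl = prefl

infixl 40 _[_≔_]
_[_≔_] : {A : Set} → (ℕ → A) → ℕ → A → ℕ → A
(f [ a ≔ b ]) z with z ≟ a
... | yes _ = b
... | no _  = f z

module _ {A : Set} (f : ℕ → A) (a : ℕ) (b : A) where

  ≔-same : (f [ a ≔ b ]) a ≡ b
  ≔-same with a ≟ a
  ... | yes _   = refl
  ... | no a≢a = ⊥-elim (a≢a refl)

  ≔-other : ∀ {z} → z ≢ a → (f [ a ≔ b ]) z ≡ f z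
  ≔-other {z} z≢a with z ≟ a
  ... | yes z≡a = ⊥-elim (z≢a z≡a)
  ... | no _    = refl

  ≔-preserves : (R : A → Set) → R b → (∀ z → R (f z)) → ∀ z → R ((f [ a ≔ b ]) z)
  ≔-preserves R Rb Rf z with z ≟ a
  ... | yes _ = Rb
  ... | no _  = Rf z

one-or-two : ∀ {y} → ⟦ 2 ⟧ y → y ≡ 1 ⊎ y ≡ 2
one-or-two {1} _ = inj₁ refl
one-or-two {2} _ = inj₂ refl
one-or-two {0} (() , _)
one-or-two {suc (suc (suc _))} (_ , s≤s (s≤s ()))

module _ {S : Signature} where

  occurs? : ∀ x (t : Term S) → Dec (Occurs x t)
  occurs? x (var y) with x ≟ y
  ... | yes refl = yes here
  ... | no x≢y   = no λ { here → x≢y refl }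
  occurs? x (op o ts) with any? (λ i → occurs? x (ts i))
  ... | yes (i , x∈tsi) = yes (under i x∈tsi)
  ... | no x∉ts         = no λ { (under i x∈tsi) → x∉ts (i , x∈tsi) }

  occurs-var⁻ : ∀ {x y} → Occurs {S} y (var x) → y ≡ x
  occurs-var⁻ here = refl

  occurs-subst⁺ : ∀ {σ : ℕ → Term S} {x y} (t : Term S) →
                  Occurs x t → Occurs y (σ x) → Occurs y (subst σ t)
  occurs-subst⁺ (var x)   here          y∈σx = y∈σx
  occurs-subst⁺ (op o ts) (under i x∈t) y∈σx = under i (occurs-subst⁺ (ts i) x∈t y∈σx)

  occurs-subst⁻ : ∀ {σ : ℕ → Term S} {y} (t : Term S) →
                  Occurs y (subst σ t) → ∃ λ x → Occurs x t × Occurs y (σ x)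
  occurs-subst⁻ (var x)   y∈σx = x , here , y∈σx
  occurs-subst⁻ (op o ts) (under i y∈) with occurs-subst⁻ (ts i) y∈
  ... | x , x∈t , y∈σx = x , under i x∈t , y∈σx

occurs-translate⁻ : ∀ {S D} (ι : SigIncl S D) {x} (t : Term S) → Occurs x (translate ι t) → Occurs x t
occurs-translate⁻ ι (var x)   here = here
occurs-translate⁻ ι (op o ts) (under i x∈) =
  under (cast (ar-eq ι o) i) (occurs-translate⁻ ι (ts (cast (ar-eq ι o) i)) x∈)

⊢-translate : ∀ {S D} (ι : SigIncl S D) {Y} {t : Term S} → Y ⊢ t → Y ⊢ translate ι t
⊢-translate ι {t = t} t⊢ x x∈ = t⊢ x (occurs-translate⁻ ι t x∈)

module _ {T : Theory} where

  subst-cong : (σ τ : ℕ → TermOf T) (t : TermOf T) →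
               (∀ x → Occurs x t → σ x =[ T ] τ x) → subst σ t =[ T ] subst τ t
  subst-cong σ τ (var x)   σ≈τ = σ≈τ x here
  subst-cong σ τ (op o ts) σ≈τ = pcong o λ i → subst-cong σ τ (ts i) λ x x∈ → σ≈τ x (under i x∈)

  subst-subst : (σ τ : ℕ → TermOf T) (t : TermOf T) →
                subst σ (subst τ t) =[ T ] subst (subst σ ∘ τ) t
  subst-subst σ τ (var x)   = prefl
  subst-subst σ τ (op o ts) = pcong o λ i → subst-subst σ τ (ts i)

  subst-id : (t : TermOf T) → subst var t =[ T ] t
  subst-id (var x)   = prefl
  subst-id (op o ts) = pcong o λ i → subst-id (ts i)

  subst-resp : (σ : ℕ → TermOf T) {s t : TermOf T} → s =[ T ] t → subst σ s =[ T ] subst σ t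
  subst-resp σ prefl          = prefl
  subst-resp σ (psym s≈t)     = psym (subst-resp σ s≈t)
  subst-resp σ (ptrans s≈ ≈t) = ptrans (subst-resp σ s≈) (subst-resp σ ≈t)
  subst-resp σ (pcong o ≈s)   = pcong o λ i → subst-resp σ (≈s i)
  subst-resp σ (pax e τ)      =
    ptrans (subst-subst σ τ (lhs T e)) (ptrans (pax e _) (psym (subst-subst σ τ (rhs T e))))

  consistent-if-not-variable : (w : TermOf T) (x : ℕ) → ¬ (w =[ T ] var x) → Consistent T
  consistent-if-not-variable w x w≉x a b a≢b a≈b = w≉x (begin
      w           ≡⟨ ≔-same _ a w ⟨
      σ a         ≈⟨ subst-resp σ a≈b ⟩
      σ b         ≡⟨ ≔-other _ a w (a≢b ∘ sym) ⟩
      var x       ∎)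
    where
      open ≈-Reasoning T
      σ : ℕ → TermOf T
      σ = (λ _ → var x) [ a ≔ w ]

  var-occurs : Consistent T → ∀ {a r} → var a =[ T ] r → Occurs a r
  var-occurs consistent {a} {r} a≈r with occurs? a r
  ... | yes a∈r = a∈r
  ... | no a∉r  = ⊥-elim (consistent (suc a) a 1+n≢n (begin
      var (suc a)  ≡⟨ ≔-same var a _ ⟨
      σ a          ≈⟨ subst-resp σ a≈r ⟩
      subst σ r    ≈⟨ subst-cong σ var r (λ z z∈r →
                        ≡⇒prov (≔-other var a _ λ { refl → a∉r z∈r })) ⟩
      subst var r  ≈⟨ subst-id r ⟩
      r            ≈⟨ a≈r ⟨
      var a        ∎))
    where
      open ≈-Reasoning T
      σ : ℕ → TermOf T
      σ = var [ a ≔ var (suc a) ]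

  sole-variable : ∀ {y a} (ρ : ℕ → ℕ) (w : TermOf T) →
                  (∀ z → Occurs z w → z ≡ y) → var a =[ T ] rename ρ w → w =[ T ] var y
  sole-variable {y} {a} ρ w only-y a≈ρw = begin
      w                     ≈⟨ subst-id w ⟨
      subst var w           ≈⟨ subst-cong var (λ _ → var y) w (λ z z∈w →
                                 ≡⇒prov (cong var (only-y z z∈w))) ⟩
      subst (λ _ → var y) w ≈⟨ subst-subst (λ _ → var y) (var ∘ ρ) w ⟨
      subst (λ _ → var y) (rename ρ w) ≈⟨ subst-resp (λ _ → var y) a≈ρw ⟨
      var y                 ∎
    where open ≈-Reasoning T

  module _ {t : TermOf T} (t⊢ : ⟦ 2 ⟧ ⊢ t) where

    subst-cong₂ : {σ τ : ℕ → TermOf T} → (Occurs 1 t → σ 1 =[ T ] τ 1) →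
                  (Occurs 2 t → σ 2 =[ T ] τ 2) → subst σ t =[ T ] subst τ t
    subst-cong₂ {σ} {τ} σ≈τ₁ σ≈τ₂ = subst-cong σ τ t pointwise
      where
        pointwise : ∀ x → Occurs x t → σ x =[ T ] τ x
        pointwise x x∈t with one-or-two (t⊢ x x∈t)
        ... | inj₁ refl = σ≈τ₁ x∈t
        ... | inj₂ refl = σ≈τ₂ x∈t

    subst-⟨⟩ : (σ : ℕ → TermOf T) (a b : TermOf T) →
               subst σ (t ⟨ a , b ⟩) =[ T ] t ⟨ subst σ a , subst σ b ⟩
    subst-⟨⟩ σ a b = ptrans (subst-subst σ (pair a b) t) (subst-cong₂ (λ _ → prefl) (λ _ → prefl))

    occurs-⟨⟩⁻ : ∀ {a b z} → Occurs z (t ⟨ a , b ⟩) →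
                 (Occurs 1 t × Occurs z a) ⊎ (Occurs 2 t × Occurs z b)
    occurs-⟨⟩⁻ z∈ with occurs-subst⁻ t z∈
    ... | x , x∈t , z∈ with one-or-two (t⊢ x x∈t)
    ...   | inj₁ refl = inj₁ (x∈t , z∈)
    ...   | inj₂ refl = inj₂ (x∈t , z∈)

    ⊢-⟨⟩ : ∀ {Y a b} → Y ⊢ a → Y ⊢ b → Y ⊢ t ⟨ a , b ⟩
    ⊢-⟨⟩ a⊢ b⊢ z z∈ with occurs-⟨⟩⁻ z∈
    ... | inj₁ (_ , z∈a) = a⊢ z z∈a
    ... | inj₂ (_ , z∈b) = b⊢ z z∈b

translate-subst : ∀ {U S} (ι : SigIncl S (sig U)) (σ : ℕ → Term S) (t : Term S) →
                  translate ι (subst σ t) =[ U ] subst (translate ι ∘ σ) (translate ι t)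
translate-subst ι σ (var x)   = prefl
translate-subst ι σ (op o ts) = pcong (fun ι o) λ i → translate-subst ι σ (ts (cast (ar-eq ι o) i))

translate-resp : ∀ {U T} (c : Contains U T) {s t : TermOf T} →
                 s =[ T ] t → translate (incl c) s =[ U ] translate (incl c) t
translate-resp c prefl          = prefl
translate-resp c (psym s≈t)     = psym (translate-resp c s≈t)
translate-resp c (ptrans s≈ ≈t) = ptrans (translate-resp c s≈) (translate-resp c ≈t)
translate-resp c (pcong o ≈s)   = pcong (fun (incl c) o) λ i → translate-resp c (≈s (cast (ar-eq (incl c) o) i))
translate-resp {T = T} c (pax e σ) =
  ptrans (translate-subst (incl c) σ (lhs T e))
         (ptrans (subst-resp _ (eqns c e)) (psym (translate-subst (incl c) σ (rhs T e))))

translate-⟨⟩ : ∀ {U S} (ι : SigIncl S (sig U)) {t : Term S} → ⟦ 2 ⟧ ⊢ t → (a b : Term S) →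
               translate ι (t ⟨ a , b ⟩) =[ U ] translate ι t ⟨ translate ι a , translate ι b ⟩
translate-⟨⟩ ι {t} t⊢ a b =
  ptrans (translate-subst ι (pair a b) t) (subst-cong₂ (⊢-translate ι t⊢) (λ _ → prefl) (λ _ → prefl))

module _ {P : Theory} {p : TermOf P} (p⊢ : ⟦ 2 ⟧ ⊢ p)
         (comm : p ⟨ var 1 , var 2 ⟩ =[ P ] p ⟨ var 2 , var 1 ⟩) where
  open ≈-Reasoning P

  p-swap : ∀ a b → p ⟨ a , b ⟩ =[ P ] p ⟨ b , a ⟩
  p-swap a b = begin
    p ⟨ a , b ⟩                          ≈⟨ subst-⟨⟩ p⊢ (pair a b) (var 1) (var 2) ⟨
    subst (pair a b) (p ⟨ var 1 , var 2 ⟩) ≈⟨ subst-resp (pair a b) comm ⟩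
    subst (pair a b) (p ⟨ var 2 , var 1 ⟩) ≈⟨ subst-⟨⟩ p⊢ (pair a b) (var 2) (var 1) ⟩
    p ⟨ b , a ⟩                          ∎

module _ {P : Theory} {p : TermOf P} (p⊢ : ⟦ 2 ⟧ ⊢ p) {e : TermOf P}
         (unit : p ⟨ var 1 , e ⟩ =[ P ] var 1) where

  p-unit-at : ∀ a → p ⟨ var a , subst (λ _ → var a) e ⟩ =[ P ] var a
  p-unit-at a = ptrans (psym (subst-⟨⟩ p⊢ (λ _ → var a) (var 1) e)) (subst-resp (λ _ → var a) unit)

  module _ (comm : p ⟨ var 1 , var 2 ⟩ =[ P ] p ⟨ var 2 , var 1 ⟩) (consistent : Consistent P) where
    open ≈-Reasoning P

    p-uses-1 : Occurs 1 p
    p-uses-1 with occurs? 1 p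
    ... | yes 1∈p = 1∈p
    ... | no 1∉p with occurs-⟨⟩⁻ {P} p⊢ (var-occurs consistent (begin
        var 1                ≈⟨ unit ⟨
        p ⟨ var 1 , e ⟩      ≈⟨ p-swap p⊢ comm (var 1) e ⟩
        p ⟨ e , var 1 ⟩      ≈⟨ subst-cong₂ p⊢ (⊥-elim ∘ 1∉p) (λ _ → prefl) ⟩
        p ⟨ var 2 , var 1 ⟩  ≈⟨ comm ⟨
        p ⟨ var 1 , var 2 ⟩  ∎))
    ...   | inj₁ (1∈p , _) = ⊥-elim (1∉p 1∈p)
    ...   | inj₂ (_ , ())

    p-uses-2 : Occurs 2 p
    p-uses-2 with occurs? 2 p
    ... | yes 2∈p = 2∈p
    ... | no 2∉p with occurs-⟨⟩⁻ {P} p⊢ (var-occurs consistent (begin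
        var 1                ≈⟨ unit ⟨
        p ⟨ var 1 , e ⟩      ≈⟨ subst-cong₂ p⊢ (λ _ → prefl) (⊥-elim ∘ 2∉p) ⟩
        p ⟨ var 1 , var 2 ⟩  ≈⟨ comm ⟩
        p ⟨ var 2 , var 1 ⟩  ∎))
    ...   | inj₁ (_ , ())
    ...   | inj₂ (2∈p , _) = ⊥-elim (2∉p 2∈p)

module _ {P : Theory} {p : TermOf P} (p⊢ : ⟦ 2 ⟧ ⊢ p) (TP : TermSet P) (stable : Stable P TP)
         (p-normal : ∀ (n : ℕ) (p' : TermOf P) → TP p' → ⟦ n ⟧ ⊢ p ⟨ var 1 , var 2 ⟩ →
                     ⟦ n ⟧ ⊢ p' → p ⟨ var 1 , var 2 ⟩ =[ P ] p' → ⟦ 2 ⟧ ⊢ p') where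

  p-variables : ∀ {a b r} → a ≢ b → TP r → p ⟨ var a , var b ⟩ =[ P ] r →
                ∀ {z} → Occurs z r → z ≡ a ⊎ z ≡ b
  p-variables {a} {b} {r} a≢b r∈TP p≈r {z} z∈r with z ≟ a | z ≟ b
  ... | yes z≡a | _       = inj₁ z≡a
  ... | no _    | yes z≡b = inj₂ z≡b
  ... | no z≢a  | no z≢b  =
    ⊥-elim (n≮n 2 (≤-trans (≤-reflexive (sym σz≡3)) (proj₂ (σr⊢ (σ z) (occurs-subst⁺ r z∈r here)))))
    where
      σ : ℕ → ℕ
      σ = (λ _ → 3) [ b ≔ 2 ] [ a ≔ 1 ]
      σz≡3 : σ z ≡ 3
      σz≡3 = trans (≔-other _ a 1 z≢a) (≔-other _ b 2 z≢b)
      σ-range : ∀ y → ⟦ 3 ⟧ (σ y)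
      σ-range = ≔-preserves _ a 1 ⟦ 3 ⟧ (s≤s z≤n , s≤s z≤n)
                  (≔-preserves _ b 2 ⟦ 3 ⟧ (s≤s z≤n , s≤s (s≤s z≤n))
                     (λ _ → s≤s z≤n , s≤s (s≤s (s≤s z≤n))))
      p≈σr : p ⟨ var 1 , var 2 ⟩ =[ P ] rename σ r
      p≈σr = begin
        p ⟨ var 1 , var 2 ⟩          ≡⟨ cong₂ (λ x y → p ⟨ var x , var y ⟩)
                                          (sym (≔-same _ a 1))
                                          (sym (trans (≔-other _ a 1 (a≢b ∘ sym)) (≔-same _ b 2))) ⟩
        p ⟨ var (σ a) , var (σ b) ⟩  ≈⟨ subst-⟨⟩ {P} p⊢ (var ∘ σ) (var a) (var b) ⟨
        rename σ (p ⟨ var a , var b ⟩) ≈⟨ subst-resp (var ∘ σ) p≈r ⟩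
        rename σ r                   ∎
        where open ≈-Reasoning P
      σr⊢ : ⟦ 2 ⟧ ⊢ rename σ r
      σr⊢ = p-normal 3 (rename σ r) (stable r σ r∈TP)
              (⊢-⟨⟩ {P} p⊢ (λ { _ here → s≤s z≤n , s≤s z≤n })
                           (λ { _ here → s≤s z≤n , s≤s (s≤s z≤n) }))
              (λ y y∈ → case-σ y (occurs-subst⁻ r y∈))
              p≈σr
        where
          case-σ : ∀ y → ∃ (λ x → Occurs x r × Occurs y (var (σ x))) → ⟦ 3 ⟧ y
          case-σ _ (x , _ , here) = σ-range x

module _ {V : Theory} {v : TermOf V} (v⊢ : ⟦ 2 ⟧ ⊢ v) (TV : TermSet V) (universal : Universal V TV)
         (idempotent : v ⟨ var 1 , var 1 ⟩ =[ V ] var 1)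
         (variable-normal : ∀ (v' : TermOf V) (x : ℕ) → TV v' → var x =[ V ] v' → ｛ x ｝ ⊢ v')
         (v-normal : ∀ (v' : TermOf V) → TV v' → v ⟨ var 1 , var 2 ⟩ =[ V ] v' →
                     ¬ (｛ 1 ｝ ⊢ v') × ¬ (｛ 2 ｝ ⊢ v')) where

  v-not-variable : ∀ x → ¬ (v ⟨ var 1 , var 2 ⟩ =[ V ] var x)
  v-not-variable x v≈x with universal (v ⟨ var 1 , var 2 ⟩)
  ... | w , w∈TV , v≈w with x ≟ 2
  ...   | yes refl = proj₂ (v-normal w w∈TV v≈w) (variable-normal w 2 w∈TV (ptrans (psym v≈x) v≈w))
  ...   | no x≢2   = proj₁ (v-normal w w∈TV v≈w) (variable-normal w 1 w∈TV (begin
      var 1                            ≈⟨ idempotent ⟨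
      v ⟨ var 1 , var 1 ⟩              ≈⟨ subst-⟨⟩ {V} v⊢ κ (var 1) (var 2) ⟨
      subst κ (v ⟨ var 1 , var 2 ⟩)    ≈⟨ subst-resp κ v≈x ⟩
      κ x                              ≡⟨ ≔-other var 2 (var 1) x≢2 ⟩
      var x                            ≈⟨ v≈x ⟨
      v ⟨ var 1 , var 2 ⟩              ≈⟨ v≈w ⟩
      w                                ∎))
    where
      open ≈-Reasoning V
      κ : ℕ → TermOf V
      κ = var [ 2 ≔ var 1 ]

  V-consistent : Consistent V
  V-consistent = consistent-if-not-variable (v ⟨ var 1 , var 2 ⟩) 1 (v-not-variable 1)

straight crossed : ℕ → ℕ
straight 2 = 1
straight 4 = 3
straight z = z
crossed 2 = 3
crossed 4 = 1
crossed z = z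

recover : ℕ → ℕ → ℕ
recover 1 3 = 2
recover 3 1 = 4
recover a _ = a

recover-straight-crossed : ∀ z → recover (straight z) (crossed z) ≡ z
recover-straight-crossed 0 = refl
recover-straight-crossed 1 = refl
recover-straight-crossed 2 = refl
recover-straight-crossed 3 = refl
recover-straight-crossed 4 = refl
recover-straight-crossed (suc (suc (suc (suc (suc _))))) = refl

module _ {P V U : Theory} (C : Composite P V U) where
  open Composite C

  P̂ : TermOf P → TermOf U
  P̂ = translate (incl containsT)

  V̂ : TermOf V → TermOf U
  V̂ = translate (incl containsS)

  subst-sep : (σ : ℕ → TermOf V) (t : TermOf P) (s : ℕ → TermOf V) →
              subst (V̂ ∘ σ) (sep (t , s)) =[ U ] sep (t , subst σ ∘ s)
  subst-sep σ t s = ptrans (subst-subst _ _ (P̂ t))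
                           (subst-cong _ _ (P̂ t) λ x _ → psym (translate-subst _ σ (s x)))

  nonvariable-not-pure : Consistent P → ∀ {w q} → (∀ x → ¬ (w =[ V ] var x)) → ¬ (V̂ w =[ U ] P̂ q)
  nonvariable-not-pure consistent {w} {q} w-nonvar w≈q
    with uniqueness (var 1 , λ _ → w) (q , var) (V̂ w) prefl (ptrans w≈q (psym (subst-id (P̂ q))))
  ... | f , f' , s̄ , f1≈f'q , w≈s̄ , x≈s̄ with occurs-subst⁻ q (var-occurs consistent f1≈f'q)
  ...   | x , x∈q , f1∈f'x = w-nonvar x (begin
      w         ≈⟨ w≈s̄ 1 here ⟩
      s̄ (f 1)   ≡⟨ cong s̄ (occurs-var⁻ f1∈f'x) ⟩
      s̄ (f' x)  ≈⟨ x≈s̄ x x∈q ⟨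
      var x     ∎)
    where open ≈-Reasoning V

  module _ {p : TermOf P} (p⊢ : ⟦ 2 ⟧ ⊢ p) (1∈p : Occurs 1 p) (2∈p : Occurs 2 p)
           (consistentV : Consistent V) (TP : TermSet P) (stableP : Stable P TP)
           (p-vars : ∀ {a b r} → a ≢ b → TP r → p ⟨ var a , var b ⟩ =[ P ] r →
                          ∀ {z} → Occurs z r → z ≡ a ⊎ z ≡ b) where

    separated-p⟨1,3⟩ : ∀ {t s} → TP t → sep (t , s) =[ U ] P̂ (p ⟨ var 1 , var 3 ⟩) →
                       ∃ λ c → ∀ x → Occurs x t → s x =[ V ] var (c x)
    separated-p⟨1,3⟩ {t} {s} t∈TP sep≈p
      with uniqueness (t , s) (p ⟨ var 1 , var 3 ⟩ , var) (sep (t , s)) prefl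
                      (ptrans sep≈p (psym (subst-id _)))
    ... | f , f' , s̄ , ft≈f'p , s≈s̄ , x≈s̄ = g ∘ f , λ x x∈t →
      ptrans (s≈s̄ x x∈t)
             (s̄-variable (p-vars f'1≢f'3 (stableP t f t∈TP) p≈ft (occurs-subst⁺ t x∈t here)))
      where
        open ≈-Reasoning V
        1≈s̄ : var 1 =[ V ] s̄ (f' 1)
        1≈s̄ = x≈s̄ 1 (occurs-subst⁺ p 1∈p here)
        3≈s̄ : var 3 =[ V ] s̄ (f' 3)
        3≈s̄ = x≈s̄ 3 (occurs-subst⁺ p 2∈p here)
        f'1≢f'3 : f' 1 ≢ f' 3
        f'1≢f'3 eq = consistentV 1 3 (λ ()) (begin
          var 1     ≈⟨ 1≈s̄ ⟩
          s̄ (f' 1)  ≡⟨ cong s̄ eq ⟩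
          s̄ (f' 3)  ≈⟨ 3≈s̄ ⟨
          var 3     ∎)
        p≈ft : p ⟨ var (f' 1) , var (f' 3) ⟩ =[ P ] rename f t
        p≈ft = psym (ptrans ft≈f'p (subst-⟨⟩ {P} p⊢ (var ∘ f') (var 1) (var 3)))
        -- By (P3), f sends the variables of t into {f' 1, f' 3}, where s̄ is var 1 resp. var 3.
        g : ℕ → ℕ
        g = (λ _ → 3) [ f' 1 ≔ 1 ]
        s̄-variable : ∀ {y} → y ≡ f' 1 ⊎ y ≡ f' 3 → s̄ y =[ V ] var (g y)
        s̄-variable (inj₁ refl) = begin
          s̄ (f' 1)     ≈⟨ 1≈s̄ ⟨
          var 1        ≡⟨ cong var (≔-same _ (f' 1) 1) ⟨
          var (g (f' 1)) ∎
        s̄-variable (inj₂ refl) = begin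
          s̄ (f' 3)     ≈⟨ 3≈s̄ ⟨
          var 3        ≡⟨ cong var (≔-other _ (f' 1) 1 (f'1≢f'3 ∘ sym)) ⟨
          var (g (f' 3)) ∎

    module _ (universalP : Universal P TP) (TV : TermSet V) (stableV : Stable V TV)
             (universalV : Universal V TV)
             (variable-normal : ∀ (v' : TermOf V) (x : ℕ) → TV v' → var x =[ V ] v' → ｛ x ｝ ⊢ v') where

      renamed-to-variable : ∀ {w a} ρ → TV w → var a =[ V ] rename ρ w → ∀ {z} → Occurs z w → ρ z ≡ a
      renamed-to-variable {w} {a} ρ w∈TV a≈ρw z∈w =
        variable-normal (rename ρ w) a (stableV w ρ w∈TV) a≈ρw _ (occurs-subst⁺ w z∈w here)

      variable-if-straight-crossed : ∀ {s a b} → rename straight s =[ V ] var a →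
                                     rename crossed s =[ V ] var b → s =[ V ] var (recover a b)
      variable-if-straight-crossed {s} {a} {b} straight≈a crossed≈b with universalV s
      ... | w , w∈TV , s≈w =
        ptrans s≈w (sole-variable straight w only-recovered (var≈renamed straight straight≈a))
        where
          var≈renamed : ∀ ρ {c} → rename ρ s =[ V ] var c → var c =[ V ] rename ρ w
          var≈renamed ρ ρs≈c = ptrans (psym ρs≈c) (subst-resp _ s≈w)
          only-recovered : ∀ z → Occurs z w → z ≡ recover a b
          only-recovered z z∈w = trans (sym (recover-straight-crossed z))
            (cong₂ recover (renamed-to-variable straight w∈TV (var≈renamed straight straight≈a) z∈w)
                           (renamed-to-variable crossed w∈TV (var≈renamed crossed crossed≈b) z∈w))

      pure-if-collapses : ∀ u → rename straight u =[ U ] P̂ (p ⟨ var 1 , var 3 ⟩) →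
                          rename crossed u =[ U ] P̂ (p ⟨ var 1 , var 3 ⟩) → ∃ λ q → u =[ U ] P̂ q
      pure-if-collapses u straight≈p crossed≈p with separation u
      ... | (t₀ , s) , u≈sep₀ with universalP t₀
      ...   | t , t∈TP , t₀≈t = rename y t , (begin
          u                  ≈⟨ u≈sep ⟩
          sep (t , s)        ≈⟨ subst-cong _ _ (P̂ t) (λ x x∈ →
                                  translate-resp containsS (s≈y x (occurs-translate⁻ _ t x∈))) ⟩
          sep (t , var ∘ y)  ≈⟨ translate-subst _ (var ∘ y) t ⟨
          P̂ (rename y t)     ∎)
        where
          open ≈-Reasoning U
          u≈sep : u =[ U ] sep (t , s)
          u≈sep = ptrans u≈sep₀ (subst-resp _ (translate-resp containsT t₀≈t))
          VariableAfter : (ℕ → ℕ) → Set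
          VariableAfter ρ = ∃ λ c → ∀ x → Occurs x t → rename ρ (s x) =[ V ] var (c x)
          variable-after : ∀ ρ → rename ρ u =[ U ] P̂ (p ⟨ var 1 , var 3 ⟩) → VariableAfter ρ
          variable-after ρ ρu≈p = separated-p⟨1,3⟩ t∈TP (begin
            sep (t , rename ρ ∘ s)  ≈⟨ subst-sep (var ∘ ρ) t s ⟨
            rename ρ (sep (t , s))  ≈⟨ subst-resp _ u≈sep ⟨
            rename ρ u              ≈⟨ ρu≈p ⟩
            P̂ (p ⟨ var 1 , var 3 ⟩) ∎)
          cS : VariableAfter straight
          cS = variable-after straight straight≈p
          cC : VariableAfter crossed
          cC = variable-after crossed crossed≈p
          y : ℕ → ℕ
          y x = recover (proj₁ cS x) (proj₁ cC x)
          s≈y : ∀ x → Occurs x t → s x =[ V ] var (y x)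
          s≈y x x∈t = variable-if-straight-crossed (proj₂ cS x x∈t) (proj₂ cC x x∈t)

  module _ {p : TermOf P} (p⊢ : ⟦ 2 ⟧ ⊢ p) {v : TermOf V} (v⊢ : ⟦ 2 ⟧ ⊢ v) where
    open ≈-Reasoning U

    p̂ : ℕ → ℕ → TermOf U
    p̂ a b = P̂ (p ⟨ var a , var b ⟩)

    u : TermOf U
    u = V̂ v ⟨ p̂ 1 3 , p̂ 2 4 ⟩

    v̂⊢ : ⟦ 2 ⟧ ⊢ V̂ v
    v̂⊢ = ⊢-translate _ v⊢

    subst-u : ∀ σ → subst σ u =[ U ] V̂ v ⟨ subst σ (p̂ 1 3) , subst σ (p̂ 2 4) ⟩
    subst-u σ = subst-⟨⟩ v̂⊢ σ (p̂ 1 3) (p̂ 2 4)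

    rename-p̂ : ∀ ρ a b → rename ρ (p̂ a b) =[ U ] p̂ (ρ a) (ρ b)
    rename-p̂ ρ a b = ptrans (psym (translate-subst _ (var ∘ ρ) (p ⟨ var a , var b ⟩)))
                            (translate-resp containsT (subst-⟨⟩ {P} p⊢ (var ∘ ρ) (var a) (var b)))

    module _ (idempotent : v ⟨ var 1 , var 1 ⟩ =[ V ] var 1) where

      v̂-idempotent : ∀ X → V̂ v ⟨ X , X ⟩ =[ U ] X
      v̂-idempotent X = begin
        V̂ v ⟨ X , X ⟩                              ≈⟨ subst-⟨⟩ v̂⊢ (λ _ → X) (var 1) (var 1) ⟨
        subst (λ _ → X) (V̂ v ⟨ var 1 , var 1 ⟩)    ≈⟨ subst-resp _ (translate-⟨⟩ _ v⊢ _ _) ⟨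
        subst (λ _ → X) (V̂ (v ⟨ var 1 , var 1 ⟩))  ≈⟨ subst-resp _ (translate-resp containsS idempotent) ⟩
        X                                          ∎

      u-straight : rename straight u =[ U ] p̂ 1 3
      u-straight = begin
        rename straight u          ≈⟨ subst-u _ ⟩
        V̂ v ⟨ rename straight (p̂ 1 3) , rename straight (p̂ 2 4) ⟩
                                   ≈⟨ subst-cong₂ v̂⊢ (λ _ → rename-p̂ straight 1 3)
                                                     (λ _ → rename-p̂ straight 2 4) ⟩
        V̂ v ⟨ p̂ 1 3 , p̂ 1 3 ⟩      ≈⟨ v̂-idempotent _ ⟩
        p̂ 1 3                      ∎

      u-crossed : p ⟨ var 1 , var 2 ⟩ =[ P ] p ⟨ var 2 , var 1 ⟩ → rename crossed u =[ U ] p̂ 1 3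
      u-crossed comm = begin
        rename crossed u           ≈⟨ subst-u _ ⟩
        V̂ v ⟨ rename crossed (p̂ 1 3) , rename crossed (p̂ 2 4) ⟩
                                   ≈⟨ subst-cong₂ v̂⊢ (λ _ → rename-p̂ crossed 1 3) (λ _ →
                                        ptrans (rename-p̂ crossed 2 4)
                                               (translate-resp containsT (p-swap p⊢ comm (var 3) (var 1)))) ⟩
        V̂ v ⟨ p̂ 1 3 , p̂ 1 3 ⟩      ≈⟨ v̂-idempotent _ ⟩
        p̂ 1 3                      ∎

    module _ {e : TermOf P} (unit-at : ∀ a → p ⟨ var a , subst (λ _ → var a) e ⟩ =[ P ] var a) where

      units : ℕ → TermOf P
      units 3 = subst (λ _ → var 1) e
      units 4 = subst (λ _ → var 2) e
      units z = var z

      p̂-at-units : ∀ a b → units a ≡ var a → units b ≡ subst (λ _ → var a) e →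
                   subst (P̂ ∘ units) (p̂ a b) =[ U ] var a
      p̂-at-units a b ua≡a ub≡e = begin
        subst (P̂ ∘ units) (p̂ a b)         ≈⟨ translate-subst _ units (p ⟨ var a , var b ⟩) ⟨
        P̂ (subst units (p ⟨ var a , var b ⟩)) ≈⟨ translate-resp containsT (subst-⟨⟩ {P} p⊢ units _ _) ⟩
        P̂ (p ⟨ units a , units b ⟩)        ≡⟨ cong₂ (λ x y → P̂ (p ⟨ x , y ⟩)) ua≡a ub≡e ⟩
        P̂ (p ⟨ var a , subst (λ _ → var a) e ⟩) ≈⟨ translate-resp containsT (unit-at a) ⟩
        var a                              ∎

      v̂-pure-if-u-pure : (∃ λ q → u =[ U ] P̂ q) → ∃ λ Q → V̂ (v ⟨ var 1 , var 2 ⟩) =[ U ] P̂ Q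
      v̂-pure-if-u-pure (q , u≈q) = subst units q , (begin
        V̂ (v ⟨ var 1 , var 2 ⟩)  ≈⟨ translate-⟨⟩ _ v⊢ (var 1) (var 2) ⟩
        V̂ v ⟨ var 1 , var 2 ⟩    ≈⟨ subst-cong₂ v̂⊢ (λ _ → p̂-at-units 1 3 refl refl)
                                                   (λ _ → p̂-at-units 2 4 refl refl) ⟨
        V̂ v ⟨ subst (P̂ ∘ units) (p̂ 1 3) , subst (P̂ ∘ units) (p̂ 2 4) ⟩ ≈⟨ subst-u _ ⟨
        subst (P̂ ∘ units) u      ≈⟨ subst-resp _ u≈q ⟩
        subst (P̂ ∘ units) (P̂ q)  ≈⟨ translate-subst _ units q ⟨
        P̂ (subst units q)        ∎)

theorem3p21 : (P V : Theory) → Consistent P →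
    (TP : TermSet P) → Stable P TP → Universal P TP →
    (TV : TermSet V) → Stable V TV → Universal V TV →
    (p : TermOf P) → ⟦ 2 ⟧ ⊢ p →
    (v : TermOf V) → ⟦ 2 ⟧ ⊢ v →
    -- (P1)
    (p ⟨ var 1 , var 2 ⟩ =[ P ] p ⟨ var 2 , var 1 ⟩) →
    -- (P2)
    (Σ (ℕ → TermOf P) λ fp → (∀ x → Occurs x p → TP (fp x))
        × (p ⟨ var 1 , fp 2 ⟩ =[ P ] var 1)) →
    -- (P3)
    (∀ (n : ℕ) (p' : TermOf P) → TP p' → ⟦ n ⟧ ⊢ p ⟨ var 1 , var 2 ⟩ → ⟦ n ⟧ ⊢ p' →
        p ⟨ var 1 , var 2 ⟩ =[ P ] p' → ⟦ 2 ⟧ ⊢ p') →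
    -- (V1)
    (v ⟨ var 1 , var 1 ⟩ =[ V ] var 1) →
    -- (V2)
    (∀ (v' : TermOf V) (x : ℕ) → TV v' → var x =[ V ] v' → ｛ x ｝ ⊢ v') →
    -- (V3)
    (∀ (v' : TermOf V) → TV v' → v ⟨ var 1 , var 2 ⟩ =[ V ] v' →
        ¬ (｛ 1 ｝ ⊢ v') × ¬ (｛ 2 ｝ ⊢ v')) →
    ¬ HasComposite P V
theorem3p21 P V consistent TP stableP universalP TV stableV universalV p p⊢ v v⊢
            comm (fp , _ , unit) p-normal idempotent variable-normal v-normal (U , C) =
  nonvariable-not-pure C consistent
    (v-not-variable v⊢ TV universalV idempotent variable-normal v-normal)
    (proj₂ (v̂-pure-if-u-pure C p⊢ v⊢ {fp 2} (p-unit-at p⊢ unit) u-pure))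
  where
    u-pure : ∃ λ q → u C p⊢ v⊢ =[ U ] P̂ C q
    u-pure = pure-if-collapses C p⊢ (p-uses-1 p⊢ unit comm consistent) (p-uses-2 p⊢ unit comm consistent)
               (V-consistent v⊢ TV universalV idempotent variable-normal v-normal) TP stableP
               (p-variables p⊢ TP stableP p-normal) universalP TV stableV universalV variable-normal
               (u C p⊢ v⊢) (u-straight C p⊢ v⊢ idempotent) (u-crossed C p⊢ v⊢ idempotent comm)
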